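{- The set $\mathcal{X}$ is an additive $IP_0$ set: for every $r\in\mathbb{N}$ there is a sequence $(x_i)_{i=1}^r$ of positive integers such that $\sum_{i\in I}x_i\in\mathcal{X}$ for every nonempty $I\subset\{1,\dots,r\}$.
   Context: For $n\in\mathbb{N}$ and a prime $p$, $X_{n,p}=\left(n\prod_{q\mid n}q^{ -1}\right)\prod_{q\le p}q$ (products over primes $q$), and $\mathcal{X}=\{X_{n,p}: n\in\mathbb{N},\ p\text{ prime},\ p>n/2\}$. -}

module Defs where

open import Data.Nat using (ℕ; zero; suc; _+_; _*_; _/_; _<_; _≤_; NonZero)
open import Data.Nat.Properties using (m*n≢0)
open import Data.Nat.Divisibility using (_∣?_)
open import Data.Nat.Primality using (Prime; prime?)
open import Data.Fin using (Fin)
open import Data.Fin.Subset using (Subset; Nonempty; _∈_)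
open import Data.Vec using (Vec; []; _∷_)
open import Data.Bool using (true; false)
open import Data.Product using (∃; _×_; Σ)
open import Relation.Nullary using (yes; no)
open import Relation.Binary.PropositionalEquality using (_≡_)
import Data.Fin as F

primorial : ℕ → ℕ
primorial zero = 1
primorial (suc k) with prime? (suc k)
... | yes _ = suc k * primorial k
... | no  _ = primorial k

radUpTo : ℕ → ℕ → ℕ
radUpTo n zero = 1
radUpTo n (suc k) with prime? (suc k) | suc k ∣? n
... | yes _ | yes _ = suc k * radUpTo n k
... | _     | _     = radUpTo n k

-- radical of n (for n ≥ 1 every prime divisor is ≤ n): ∏_{q prime, q ∣ n} q
rad : ℕ → ℕ
rad n = radUpTo n n

instance
  radUpTo-nonZero : ∀ {n k} → NonZero (radUpTo n k)
  radUpTo-nonZero {n} {zero} = _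
  radUpTo-nonZero {n} {suc k} with prime? (suc k) | suc k ∣? n
  ... | yes _ | yes _ = m*n≢0 (suc k) (radUpTo n k) {{_}} {{radUpTo-nonZero {n} {k}}}
  ... | yes _ | no  _ = radUpTo-nonZero {n} {k}
  ... | no  _ | yes _ = radUpTo-nonZero {n} {k}
  ... | no  _ | no  _ = radUpTo-nonZero {n} {k}

-- X_{n,p} = (n ∏_{q ∣ n} q⁻¹) ∏_{q ≤ p} q   (the first factor n / rad n is an integer)
X : ℕ → ℕ → ℕ
X n p = _/_ n (rad n) {{radUpTo-nonZero {n} {n}}} * primorial p

-- membership in 𝒳 = { X_{n,p} : n ∈ ℕ (n ≥ 1), p prime, p > n/2 }  (p > n/2 ⇔ n < 2p)
inX : ℕ → Set
inX x = ∃ λ n → ∃ λ p → 1 ≤ n × Prime p × n < 2 * p × x ≡ X n p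

subsetSum : ∀ {r} → (Fin r → ℕ) → Subset r → ℕ
subsetSum {zero}  x []          = 0
subsetSum {suc r} x (true  ∷ I) = x F.zero + subsetSum (λ i → x (F.suc i)) I
subsetSum {suc r} x (false ∷ I) = subsetSum (λ i → x (F.suc i)) I

{-# OPTIONS --safe #-}
-- For a nonempty I ⊆ {0,…,r-1} write s = ∑_{i∈I} 2^i, so 1 ≤ s < 2^r.  With P(k) the product
-- of the primes ≤ k, the prime factors of s·P(s) are exactly the primes ≤ s, so its radical is
-- P(s) and X_{s·P(s),p} = s·P(p).  Taking x_i = 2^i·P(p) for one prime p > 2^r·P(2^r) therefore
-- makes every nonempty subset sum equal to X_{n,p} with n = s·P(s) < p.
module Submission where

open import Defs
open import Data.Nat using (ℕ; _<_)
open import Data.Fin using (Fin)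
open import Data.Fin.Subset using (Subset; Nonempty)
open import Data.Product using (Σ; _×_)

open import Data.Nat using (zero; suc; nonZero; _+_; _*_; _^_; _/_; _≤_; _∸_; NonZero; z≤n; s≤s; >-nonZero; nonTrivial⇒n>1)
open import Data.Nat.Properties
open import Data.Nat.Divisibility using (_∣_; _∣?_; divides; ∣⇒≤; ∣1⇒≡1; ∣m+n∣m⇒∣n; ∣n⇒∣m*n; m∣m*n)
open import Data.Nat.DivMod using (m*n/n≡m)
open import Data.Nat.Primality using (Prime; prime?; prime⇒nonTrivial; euclidsLemma)
open import Data.Nat.Primality.Factorisation using (factorise)
open import Data.Nat.ListAction using (product)
open import Data.List using ([]; _∷_)
open import Data.List.Relation.Unary.All using (_∷_)
open import Data.Fin using (toℕ) renaming (zero to fzero; suc to fsuc)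
open import Data.Vec using ([]; _∷_; there)
open import Data.Bool using (true; false)
open import Data.Product using (_,_; ∃)
open import Data.Sum using (inj₁; inj₂)
open import Data.Empty using (⊥-elim)
open import Relation.Nullary using (yes; no; ¬_)
open import Relation.Binary.PropositionalEquality using (_≡_; refl; sym; trans; cong; subst; module ≡-Reasoning)

prime⇒>1 : ∀ {q} → Prime q → 1 < q
prime⇒>1 {q} q-prime = nonTrivial⇒n>1 q {{prime⇒nonTrivial q-prime}}

/-congʳ : ∀ {m n o} .{{_ : NonZero n}} .{{_ : NonZero o}} → n ≡ o → m / n ≡ m / o
/-congʳ refl = refl

-- Instance search for NonZero is derailed by the catch-all instance radUpTo-nonZero of Defs,
-- so NonZero arguments are supplied explicitly throughout.
primorial>0 : ∀ k → 0 < primorial k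
primorial>0 zero = s≤s z≤n
primorial>0 (suc k) with prime? (suc k)
... | yes _ = ≤-trans (primorial>0 k) (m≤n*m (primorial k) (suc k) {{nonZero}})
... | no  _ = primorial>0 k

primorial-nonZero : ∀ k → NonZero (primorial k)
primorial-nonZero k = >-nonZero (primorial>0 k)

primorial-≤-suc : ∀ k → primorial k ≤ primorial (suc k)
primorial-≤-suc k with prime? (suc k)
... | yes _ = m≤n*m (primorial k) (suc k) {{nonZero}}
... | no  _ = ≤-refl

primorial-mono-≤ : ∀ {k j} → k ≤ j → primorial k ≤ primorial j
primorial-mono-≤ {j = zero} z≤n = ≤-refl
primorial-mono-≤ {k} {suc j} k≤1+j with m≤n⇒m<n∨m≡n k≤1+j
... | inj₁ (s≤s k≤j) = ≤-trans (primorial-mono-≤ k≤j) (primorial-≤-suc j)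
... | inj₂ refl      = ≤-refl

prime≤⇒∣primorial : ∀ {q} k → Prime q → q ≤ k → q ∣ primorial k
prime≤⇒∣primorial zero q-prime q≤0 = ⊥-elim (<⇒≱ (prime⇒>1 q-prime) (≤-trans q≤0 z≤n))
prime≤⇒∣primorial (suc k) q-prime q≤1+k with prime? (suc k) | m≤n⇒m<n∨m≡n q≤1+k
... | yes _         | inj₁ (s≤s q≤k) = ∣n⇒∣m*n (suc k) (prime≤⇒∣primorial k q-prime q≤k)
... | yes _         | inj₂ refl      = m∣m*n (primorial k)
... | no  _         | inj₁ (s≤s q≤k) = prime≤⇒∣primorial k q-prime q≤k
... | no  not-prime | inj₂ refl      = ⊥-elim (not-prime q-prime)

prime∣primorial⇒≤ : ∀ {q} k → Prime q → q ∣ primorial k → q ≤ k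
prime∣primorial⇒≤ zero q-prime q∣1 = ⊥-elim (<⇒≢ (prime⇒>1 q-prime) (sym (∣1⇒≡1 q∣1)))
prime∣primorial⇒≤ (suc k) q-prime q∣P with prime? (suc k)
... | no _ = m≤n⇒m≤1+n (prime∣primorial⇒≤ k q-prime q∣P)
... | yes _ with euclidsLemma (suc k) (primorial k) q-prime q∣P
...   | inj₁ q∣1+k = ∣⇒≤ {{nonZero}} q∣1+k
...   | inj₂ q∣Pk  = m≤n⇒m≤1+n (prime∣primorial⇒≤ k q-prime q∣Pk)

-- Euclid: a prime factor of P(N) + 1 cannot be ≤ N.
∃-prime> : ∀ N → ∃ λ p → Prime p × N < p
∃-prime> N with factorise (1 + primorial N) {{nonZero}}
... | record { factors = [] ; isFactorisation = P+1≡1 } =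
  ⊥-elim (<⇒≢ (s≤s (primorial>0 N)) (sym P+1≡1))
... | record { factors = q ∷ qs ; isFactorisation = factorisation ; factorsPrime = q-prime ∷ _ } =
  q , q-prime , ≰⇒> q≰N
  where
    q∣P+1 : q ∣ primorial N + 1
    q∣P+1 = divides (product qs) (trans (+-comm (primorial N) 1) (trans factorisation (*-comm q (product qs))))
    q≰N : ¬ (q ≤ N)
    q≰N q≤N = <⇒≢ (prime⇒>1 q-prime)
      (sym (∣1⇒≡1 (∣m+n∣m⇒∣n q∣P+1 (prime≤⇒∣primorial N q-prime q≤N))))

module _ {n k : ℕ}
  (prime≤k⇒∣n : ∀ {q} → Prime q → q ≤ k → q ∣ n)
  (prime∣n⇒≤k : ∀ {q} → Prime q → q ∣ n → q ≤ k) where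

  radUpTo≡primorial : ∀ {j} → j ≤ k → radUpTo n j ≡ primorial j
  radUpTo≡primorial {zero} _ = refl
  radUpTo≡primorial {suc j} 1+j≤k with prime? (suc j) | suc j ∣? n
  ... | yes _       | yes _     = cong (suc j *_) (radUpTo≡primorial (≤-trans (n≤1+n j) 1+j≤k))
  ... | yes j-prime | no  j∤n   = ⊥-elim (j∤n (prime≤k⇒∣n j-prime 1+j≤k))
  ... | no  _       | yes _     = radUpTo≡primorial (≤-trans (n≤1+n j) 1+j≤k)
  ... | no  _       | no  _     = radUpTo≡primorial (≤-trans (n≤1+n j) 1+j≤k)

  radUpTo-stable : ∀ d → radUpTo n (d + k) ≡ radUpTo n k
  radUpTo-stable zero = refl
  radUpTo-stable (suc d) with prime? (suc (d + k)) | suc (d + k) ∣? n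
  ... | yes q-prime | yes q∣n = ⊥-elim (<⇒≱ (s≤s (m≤n+m k d)) (prime∣n⇒≤k q-prime q∣n))
  ... | yes _       | no  _   = radUpTo-stable d
  ... | no  _       | yes _   = radUpTo-stable d
  ... | no  _       | no  _   = radUpTo-stable d

  rad≡primorial : k ≤ n → rad n ≡ primorial k
  rad≡primorial k≤n = begin
    radUpTo n n             ≡⟨ cong (radUpTo n) (sym (m∸n+n≡m k≤n)) ⟩
    radUpTo n (n ∸ k + k)   ≡⟨ radUpTo-stable (n ∸ k) ⟩
    radUpTo n k             ≡⟨ radUpTo≡primorial ≤-refl ⟩
    primorial k             ∎
    where open ≡-Reasoning

rad[m*primorial[m]] : ∀ m → .{{NonZero m}} → rad (m * primorial m) ≡ primorial m
rad[m*primorial[m]] m = rad≡primorial prime≤m⇒∣n prime∣n⇒≤m (m≤m*n m (primorial m) {{primorial-nonZero m}})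
  where
    prime≤m⇒∣n : ∀ {q} → Prime q → q ≤ m → q ∣ m * primorial m
    prime≤m⇒∣n q-prime q≤m = ∣n⇒∣m*n m (prime≤⇒∣primorial m q-prime q≤m)
    prime∣n⇒≤m : ∀ {q} → Prime q → q ∣ m * primorial m → q ≤ m
    prime∣n⇒≤m q-prime q∣n with euclidsLemma m (primorial m) q-prime q∣n
    ... | inj₁ q∣m = ∣⇒≤ q∣m
    ... | inj₂ q∣P = prime∣primorial⇒≤ m q-prime q∣P

X[m*primorial[m]] : ∀ m p → .{{NonZero m}} → X (m * primorial m) p ≡ m * primorial p
X[m*primorial[m]] m p = cong (_* primorial p)
  (trans (/-congʳ {{radUpTo-nonZero {m * primorial m} {m * primorial m}}} {{primorial-nonZero m}} (rad[m*primorial[m]] m))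
         (m*n/n≡m m (primorial m) {{primorial-nonZero m}}))

m*primorial∈X : ∀ m p → 0 < m → Prime p → m * primorial m < 2 * p → inX (m * primorial p)
m*primorial∈X m p m>0 p-prime n<2p =
  m * primorial m , p , ≤-trans m>0 (m≤m*n m (primorial m) {{primorial-nonZero m}}) , p-prime , n<2p ,
  sym (X[m*primorial[m]] m p {{>-nonZero m>0}})

subsetSum-*ˡ : ∀ {r} c (f : Fin r → ℕ) (I : Subset r) →
               subsetSum (λ i → c * f i) I ≡ c * subsetSum f I
subsetSum-*ˡ c f [] = sym (*-zeroʳ c)
subsetSum-*ˡ c f (true ∷ I) =
  trans (cong (c * f fzero +_) (subsetSum-*ˡ c (λ i → f (fsuc i)) I)) (sym (*-distribˡ-+ c _ _))
subsetSum-*ˡ c f (false ∷ I) = subsetSum-*ˡ c (λ i → f (fsuc i)) I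

subsetSum>0 : ∀ {r} {f : Fin r → ℕ} (I : Subset r) → (∀ i → 0 < f i) → Nonempty I → 0 < subsetSum f I
subsetSum>0 (true ∷ I)  f>0 _ = ≤-trans (f>0 fzero) (m≤m+n _ _)
subsetSum>0 (false ∷ I) f>0 (fsuc i , there i∈I) = subsetSum>0 I (λ i → f>0 (fsuc i)) (i , i∈I)

binarySum : ∀ {r} → Subset r → ℕ
binarySum = subsetSum (λ i → 2 ^ toℕ i)

binarySum<2^r : ∀ {r} (I : Subset r) → binarySum I < 2 ^ r
binarySum<2^r [] = s≤s z≤n
binarySum<2^r {suc r} (true ∷ I) rewrite subsetSum-*ˡ 2 (λ i → 2 ^ toℕ i) I =
  subst (_≤ 2 * 2 ^ r) (*-suc 2 (binarySum I)) (*-monoʳ-≤ 2 (binarySum<2^r I))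
binarySum<2^r {suc r} (false ∷ I) rewrite subsetSum-*ˡ 2 (λ i → 2 ^ toℕ i) I =
  *-monoʳ-< 2 {{nonZero}} (binarySum<2^r I)

proposition11 : (r : ℕ) → Σ (Fin r → ℕ) λ x →
    ((i : Fin r) → 0 < x i) × ((I : Subset r) → Nonempty I → inX (subsetSum x I))
proposition11 r with ∃-prime> (2 ^ r * primorial (2 ^ r))
... | p , p-prime , 2^r*P<p = x , x>0 , subsetSum∈X
  where
    x : Fin r → ℕ
    x i = primorial p * 2 ^ toℕ i

    x>0 : ∀ i → 0 < x i
    x>0 i = *-mono-< (primorial>0 p) (m^n>0 2 {{nonZero}} (toℕ i))

    subsetSum∈X : (I : Subset r) → Nonempty I → inX (subsetSum x I)
    subsetSum∈X I nonempty =
      subst inX (trans (*-comm s (primorial p)) (sym (subsetSum-*ˡ (primorial p) (λ i → 2 ^ toℕ i) I)))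
        (m*primorial∈X s p s>0 p-prime n<2p)
      where
        s : ℕ
        s = binarySum I
        s>0 : 0 < s
        s>0 = subsetSum>0 I (λ i → m^n>0 2 {{nonZero}} (toℕ i)) nonempty
        s≤2^r : s ≤ 2 ^ r
        s≤2^r = <⇒≤ (binarySum<2^r I)
        n<2p : s * primorial s < 2 * p
        n<2p = ≤-trans (s≤s (*-mono-≤ s≤2^r (primorial-mono-≤ s≤2^r)))
                 (≤-trans 2^r*P<p (m≤m+n p (p + 0)))
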